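{- Let $D$ be a minimal strong digraph, let $C_q$ be a directed cycle of length $q\ge 2$ contained in $D$, let $D'$ be the digraph obtained from $D$ by deleting all arcs of $C_q$, and let $H$ be the digraph obtained from $D'$ by contracting each strong component of $D'$ to a single vertex. Then every directed path $u_0,u_1,\dots,u_j$ in $H$ joining a minimal vertex $u_0$ of $H$ to a maximal vertex $u_j\neq u_0$ of $H$ contains at least one linear vertex of $H$.
   Context: An arc $uv$ of a digraph is transitive if there is another directed $uv$-path not using the arc $uv$. A minimal strong digraph is a strongly connected digraph with no transitive arcs. A strong component is a maximal strongly connected subdigraph. The digraph $H$ (the Hasse diagram associated to $(D,C_q)$) has one vertex per strong component of $D'$ and an arc from the vertex of $S_1$ to the vertex of $S_2$ whenever $D'$ has an arc from a vertex of $S_1$ to a vertex of $S_2$ ($S_1\neq S_2$); it is acyclic. A vertex of $H$ is minimal if its indegree in $H$ is $0$ and maximal if its outdegree in $H$ is $0$. A vertex of $H$ is linear if its indegree and outdegree in $H$ are both $1$. -}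

module Defs where

open import Data.Nat using (ℕ; _≥_)
open import Data.Fin using (Fin)
open import Data.Bool using (Bool; true; false)
open import Data.List using (List; []; _∷_; _++_; head; last; length; take)
open import Data.List.Relation.Unary.Linked using (Linked)
open import Data.List.Relation.Unary.AllPairs using (AllPairs)
open import Data.List.Relation.Unary.Any using (Any)
open import Data.Maybe using (just)
open import Data.Product using (_×_; ∃; ∃-syntax)
open import Relation.Nullary using (¬_)
open import Relation.Binary.PropositionalEquality using (_≡_)

record Digraph (n : ℕ) : Set where
  field
    adj      : Fin n → Fin n → Bool
    loopless : ∀ v → adj v v ≡ false

module _ {n : ℕ} where

  Arc : Digraph n → Fin n → Fin n → Set
  Arc D u v = Digraph.adj D u v ≡ true

  PathBy : (Fin n → Fin n → Set) → (Fin n → Fin n → Set)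
         → Fin n → Fin n → List (Fin n) → Set
  PathBy _~_ R u v vs =
    Linked R vs × AllPairs (λ a b → ¬ (a ~ b)) vs
    × head vs ≡ just u × last vs ≡ just v

  DPath : (Fin n → Fin n → Set) → Fin n → Fin n → List (Fin n) → Set
  DPath R u v vs = PathBy _≡_ R u v vs

  Reach : (Fin n → Fin n → Set) → Fin n → Fin n → Set
  Reach R u v = ∃[ vs ] DPath R u v vs

  StronglyConnected : Digraph n → Set
  StronglyConnected D = ∀ u v → Reach (Arc D) u v

  ArcWithout : Digraph n → Fin n → Fin n → Fin n → Fin n → Set
  ArcWithout D u v a b = Arc D a b × ¬ (a ≡ u × b ≡ v)

  TransitiveArc : Digraph n → Fin n → Fin n → Set
  TransitiveArc D u v = Arc D u v × Reach (ArcWithout D u v) u v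

  MinimalStrong : Digraph n → Set
  MinimalStrong D = StronglyConnected D × (∀ u v → ¬ TransitiveArc D u v)

  IsCycle : Digraph n → List (Fin n) → Set
  IsCycle D cyc = ∃[ a ] ∃[ b ] (DPath (Arc D) a b cyc × Arc D b a)

data Consec {A : Set} : List A → A → A → Set where
  here  : ∀ {x y rest} → Consec (x ∷ y ∷ rest) x y
  there : ∀ {x xs a b} → Consec xs a b → Consec (x ∷ xs) a b

module _ {n : ℕ} where

  -- arcs of the cycle v₀ … v_{q-1}: consecutive pairs of v₀ … v_{q-1} v₀
  CycArc : List (Fin n) → Fin n → Fin n → Set
  CycArc cyc a b = Consec (cyc ++ take 1 cyc) a b

  Arc' : Digraph n → List (Fin n) → Fin n → Fin n → Set
  Arc' D cyc a b = Arc D a b × ¬ CycArc cyc a b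

  SameComp : Digraph n → List (Fin n) → Fin n → Fin n → Set
  SameComp D cyc x y = Reach (Arc' D cyc) x y × Reach (Arc' D cyc) y x

  -- arcs of H (vertices of H are represented by vertices of D, up to SameComp)
  HArc : Digraph n → List (Fin n) → Fin n → Fin n → Set
  HArc D cyc x y = ∃[ a ] ∃[ b ]
    (SameComp D cyc x a × SameComp D cyc y b × Arc' D cyc a b
     × ¬ SameComp D cyc a b)

  HMinimal : Digraph n → List (Fin n) → Fin n → Set
  HMinimal D cyc x = ∀ y → ¬ HArc D cyc y x

  HMaximal : Digraph n → List (Fin n) → Fin n → Set
  HMaximal D cyc x = ∀ y → ¬ HArc D cyc x y

  -- indegree 1 and outdegree 1 in H (exactly one in-/out-neighbour component)
  HLinear : Digraph n → List (Fin n) → Fin n → Set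
  HLinear D cyc x =
    (∃[ y ] (HArc D cyc y x × ∀ z → HArc D cyc z x → SameComp D cyc z y))
    × (∃[ y ] (HArc D cyc x y × ∀ z → HArc D cyc x z → SameComp D cyc z y))

  HPath : Digraph n → List (Fin n) → Fin n → Fin n → List (Fin n) → Set
  HPath D cyc u w us = PathBy (SameComp D cyc) (HArc D cyc) u w us

{-# OPTIONS --safe #-}
-- Call an arc ab of D′ crossing if a and b lie in different strong components. As D has
-- no transitive arcs, D′ − ab cannot contain both a walk from a to C_q and a walk from
-- C_q to b: joined through the cycle, whose arcs are not in D′, they would give an
-- ab-path of D avoiding ab. So every crossing arc ab is a guarded exit of the component
-- of a (every D′-walk from a to C_q uses ab) or a guarded entry of the component of b
-- (every D′-walk from C_q to b uses ab). Every vertex reaches C_q and is reached from it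
-- in D′, so minimal and maximal components contain cycle vertices. Hence the first arc
-- of the path is a guarded entry of u₁, while the maximal uⱼ has no guarded entry; some
-- vertex on the path thus has both a guarded entry and a guarded exit, and that vertex
-- is linear: a second crossing arc into or out of its component would open a route
-- between the cycle and the component avoiding the guarded arc.
module Submission where

open import Defs
open import Level using (0ℓ)
open import Function using (_∘_; id)
open import Data.Nat using (ℕ; _≥_; zero; suc; _≤_; s≤s)
open import Data.Nat.Properties using (<⇒≤)
open import Data.Fin as Fin using (Fin; _≟_)
open import Data.Fin.Properties using (injective⇒≤; any?)
open import Data.Bool.Properties using () renaming (_≟_ to _≟ᵇ_)
open import Data.Empty using (⊥-elim)
open import Data.Product using (_×_; _,_; proj₁; proj₂; ∃; ∃₂; ∃-syntax)
open import Data.Sum using (_⊎_; inj₁; inj₂; [_,_]′)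
open import Data.Maybe using (just)
open import Data.Maybe.Relation.Binary.Connected using (Connected; just)
open import Data.List using (List; []; _∷_; _++_; last; length; take; lookup)
open import Data.List.Relation.Unary.Any as Any using (Any; here; there)
open import Data.List.Relation.Unary.All as All using ([])
open import Data.List.Relation.Unary.All.Properties using (¬Any⇒All¬)
open import Data.List.Relation.Unary.AllPairs using (AllPairs; []; _∷_)
open import Data.List.Relation.Unary.Linked using (Linked; [-]; _∷_)
open import Data.List.Relation.Unary.Linked.Properties using (++⁺)
open import Data.List.Membership.Propositional using (_∈_; _∉_; find; lose)
open import Data.List.Membership.Propositional.Properties using (∈-lookup; ∈-++⁺ˡ; ∈-++⁻)
import Data.List.Membership.DecPropositional as DecMembership
open import Relation.Binary using (Rel; Decidable; DecidableEquality; _⇒_)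
open import Relation.Binary.Construct.Closure.ReflexiveTransitive as Star
  using (Star; ε; _◅_; _◅◅_)
open import Relation.Binary.PropositionalEquality using (_≡_; _≢_; refl; sym; cong; subst)
open import Relation.Nullary using (¬_; yes; no; contradiction)
open import Relation.Nullary.Decidable using (map′; _×-dec_; _⊎-dec_; ¬?)
open import Relation.Unary using (Pred)

lookup-injective : ∀ {A : Set} {xs : List A} → AllPairs _≢_ xs →
                   ∀ i j → lookup xs i ≡ lookup xs j → i ≡ j
lookup-injective (_ ∷ _) Fin.zero Fin.zero _ = refl
lookup-injective (x≢ ∷ _) Fin.zero (Fin.suc j) eq =
  contradiction eq (All.lookup x≢ (∈-lookup j))
lookup-injective (x≢ ∷ _) (Fin.suc i) Fin.zero eq =
  contradiction (sym eq) (All.lookup x≢ (∈-lookup i))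
lookup-injective (_ ∷ distinct) (Fin.suc i) (Fin.suc j) eq =
  cong Fin.suc (lookup-injective distinct i j eq)

distinct⇒length≤ : ∀ {n} {xs : List (Fin n)} → AllPairs _≢_ xs → length xs ≤ n
distinct⇒length≤ distinct = injective⇒≤ (λ {i} {j} → lookup-injective distinct i j)

last-∷ʳ : ∀ {A : Set} (xs : List A) x → last (xs ++ x ∷ []) ≡ just x
last-∷ʳ [] x = refl
last-∷ʳ (_ ∷ []) x = refl
last-∷ʳ (_ ∷ y ∷ ys) x = last-∷ʳ (y ∷ ys) x

module _ {A : Set} {R : Rel A 0ℓ} where

  star-preserves : ∀ {P : Pred A 0ℓ} → (∀ {a b} → R a b → P a → P b) →
                   ∀ {x y} → Star R x y → P x → P y
  star-preserves step ε = id
  star-preserves step (r ◅ s) = star-preserves step s ∘ step r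

  star-reflects : ∀ {P : Pred A 0ℓ} → (∀ {a b} → R a b → P b → P a) →
                  ∀ {x y} → Star R x y → P y → P x
  star-reflects step ε = id
  star-reflects step (r ◅ s) = step r ∘ star-reflects step s

  linked⇒star : ∀ {x y vs} → Linked R (x ∷ vs) → last (x ∷ vs) ≡ just y → Star R x y
  linked⇒star {vs = []} _ refl = ε
  linked⇒star {vs = _ ∷ _} (r ∷ linked) last≡ = r ◅ linked⇒star linked last≡

  module _ {S : Rel A 0ℓ} (S? : Decidable S) where

    walk-avoids-or-meets : ∀ {x y} → Star R x y →
      Star (λ u v → R u v × ¬ S u v) x y
      ⊎ (∃₂ λ c d → S c d × Star (λ u v → R u v × ¬ S u v) x c)
        × (∃₂ λ c d → S c d × Star (λ u v → R u v × ¬ S u v) d y)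
    walk-avoids-or-meets ε = inj₁ ε
    walk-avoids-or-meets {x} (_◅_ {j = z} r s) with S? x z | walk-avoids-or-meets s
    ... | yes sxz | inj₁ w = inj₂ ((x , z , sxz , ε) , (x , z , sxz , w))
    ... | yes sxz | inj₂ (_ , lastArc) = inj₂ ((x , z , sxz , ε) , lastArc)
    ... | no ¬sxz | inj₁ w = inj₁ ((r , ¬sxz) ◅ w)
    ... | no ¬sxz | inj₂ ((c , d , scd , w) , lastArc) =
      inj₂ ((c , d , scd , (r , ¬sxz) ◅ w) , lastArc)

module _ {n : ℕ} {R : Rel (Fin n) 0ℓ} where
  open DecMembership (_≟_ {n}) using (_∈?_)

  -- The vertex list of the path is x ∷ vs.
  data SimplePath : Fin n → Fin n → List (Fin n) → Set where
    single : ∀ {x} → SimplePath x x []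
    cons   : ∀ {x z y vs} → R x z → x ∉ z ∷ vs → SimplePath z y vs → SimplePath x y (z ∷ vs)

  simplePath-suffix : ∀ {x y w vs} → SimplePath x y vs → w ∈ x ∷ vs → ∃ (SimplePath w y)
  simplePath-suffix p (here refl) = _ , p
  simplePath-suffix single (there ())
  simplePath-suffix (cons _ _ p) (there w∈) = simplePath-suffix p w∈

  star⇒simplePath : ∀ {x y} → Star R x y → ∃ (SimplePath x y)
  star⇒simplePath ε = _ , single
  star⇒simplePath {x} (_◅_ {j = z} r s) with star⇒simplePath s
  ... | vs , p with x ∈? (z ∷ vs)
  ...   | yes x∈ = simplePath-suffix p x∈
  ...   | no x∉ = _ , cons r x∉ p

  simplePath⇒dPath : ∀ {x y vs} → SimplePath x y vs → DPath R x y (x ∷ vs)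
  simplePath⇒dPath single = [-] , [] ∷ [] , refl , refl
  simplePath⇒dPath (cons r x∉ p) with simplePath⇒dPath p
  ... | linked , distinct , refl , last≡ = r ∷ linked , ¬Any⇒All¬ _ x∉ ∷ distinct , refl , last≡

  reach⇒star : ∀ {x y} → Reach R x y → Star R x y
  reach⇒star ([] , _ , _ , () , _)
  reach⇒star (_ ∷ _ , linked , _ , refl , last≡) = linked⇒star linked last≡

  star⇒reach : ∀ {x y} → Star R x y → Reach R x y
  star⇒reach s = _ , simplePath⇒dPath (proj₂ (star⇒simplePath s))

  Within : ℕ → Rel (Fin n) 0ℓ
  Within zero x y = x ≡ y
  Within (suc k) x y = x ≡ y ⊎ ∃[ z ] (R x z × Within k z y)

  within? : Decidable R → ∀ k → Decidable (Within k)
  within? R? zero x y = x ≟ y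
  within? R? (suc k) x y = x ≟ y ⊎-dec any? (λ z → R? x z ×-dec within? R? k z y)

  within⇒star : ∀ k {x y} → Within k x y → Star R x y
  within⇒star zero refl = ε
  within⇒star (suc k) (inj₁ refl) = ε
  within⇒star (suc k) (inj₂ (_ , r , w)) = r ◅ within⇒star k w

  simplePath⇒within : ∀ {k x y vs} → SimplePath x y vs → length vs ≤ k → Within k x y
  simplePath⇒within {zero} single _ = refl
  simplePath⇒within {suc k} single _ = inj₁ refl
  simplePath⇒within (cons r _ p) (s≤s len≤) = inj₂ (_ , r , simplePath⇒within p len≤)

  star⇒within : ∀ {x y} → Star R x y → Within n x y
  star⇒within s with star⇒simplePath s
  ... | _ , p = simplePath⇒within p (<⇒≤ (distinct⇒length≤ (proj₁ (proj₂ (simplePath⇒dPath p)))))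

  star? : Decidable R → Decidable (Star R)
  star? R? x y = map′ (within⇒star n) star⇒within (within? R? n x y)

module _ {A : Set} where

  consec⇒∈ : ∀ {xs : List A} {x y} → Consec xs x y → x ∈ xs × y ∈ xs
  consec⇒∈ here = here refl , there (here refl)
  consec⇒∈ (there c) = let x∈ , y∈ = consec⇒∈ c in there x∈ , there y∈

  linked⇒consec : ∀ {R : Rel A 0ℓ} {xs} → Linked R xs → Consec xs ⇒ R
  linked⇒consec (r ∷ _) here = r
  linked⇒consec (_ ∷ linked) (there c) = linked⇒consec linked c
  linked⇒consec [-] (there ())

  consec? : DecidableEquality A → (xs : List A) → Decidable (Consec xs)
  consec? _ [] _ _ = no λ ()
  consec? _ (_ ∷ []) _ _ = no λ { (there ()) }
  consec? eq? (a ∷ b ∷ xs) x y =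
    map′ fromSum toSum ((eq? a x ×-dec eq? b y) ⊎-dec consec? eq? (b ∷ xs) x y)
    where
    fromSum : (a ≡ x × b ≡ y) ⊎ Consec (b ∷ xs) x y → Consec (a ∷ b ∷ xs) x y
    fromSum (inj₁ (refl , refl)) = here
    fromSum (inj₂ c) = there c
    toSum : Consec (a ∷ b ∷ xs) x y → (a ≡ x × b ≡ y) ⊎ Consec (b ∷ xs) x y
    toSum here = inj₁ (refl , refl)
    toSum (there c) = inj₂ c

  consec*-to-last : ∀ {x z} (xs : List A) → x ∈ xs → last xs ≡ just z → Star (Consec xs) x z
  consec*-to-last (_ ∷ []) (here refl) refl = ε
  consec*-to-last (_ ∷ []) (there ())
  consec*-to-last (_ ∷ y ∷ ys) (here refl) last≡ =
    here ◅ Star.map there (consec*-to-last (y ∷ ys) (here refl) last≡)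
  consec*-to-last (_ ∷ y ∷ ys) (there x∈) last≡ =
    Star.map there (consec*-to-last (y ∷ ys) x∈ last≡)

  consec*-from-head : ∀ {h x} (xs : List A) → x ∈ h ∷ xs → Star (Consec (h ∷ xs)) h x
  consec*-from-head _ (here refl) = ε
  consec*-from-head [] (there ())
  consec*-from-head (_ ∷ ys) (there x∈) = here ◅ Star.map there (consec*-from-head ys x∈)

module _ {n : ℕ} where

  cycArc⇒∈ : ∀ {cyc : List (Fin n)} {x y} → CycArc cyc x y → x ∈ cyc × y ∈ cyc
  cycArc⇒∈ {h ∷ t} c = let x∈ , y∈ = consec⇒∈ c in shrink x∈ , shrink y∈
    where
    shrink : ∀ {x} → x ∈ (h ∷ t) ++ h ∷ [] → x ∈ h ∷ t
    shrink x∈ = [ id , (λ { (here refl) → here refl }) ]′ (∈-++⁻ (h ∷ t) x∈)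

  cycArc* : ∀ {cyc : List (Fin n)} {x y} → x ∈ cyc → y ∈ cyc → Star (CycArc cyc) x y
  cycArc* {h ∷ t} x∈ y∈ =
    consec*-to-last ((h ∷ t) ++ h ∷ []) (∈-++⁺ˡ x∈) (last-∷ʳ (h ∷ t) h)
    ◅◅ consec*-from-head (t ++ h ∷ []) (∈-++⁺ˡ y∈)

  cycArc⇒arc : ∀ {D : Digraph n} {cyc} → IsCycle D cyc → CycArc cyc ⇒ Arc D
  cycArc⇒arc {cyc = []} (_ , _ , (_ , _ , () , _) , _)
  cycArc⇒arc {D} {h ∷ t} (_ , _ , (linked , _ , refl , last≡) , ba) =
    linked⇒consec (++⁺ linked (subst (λ m → Connected (Arc D) m (just h)) (sym last≡) (just ba)) [-])

  cycle-inhabited : ∀ {D : Digraph n} {cyc} → IsCycle D cyc → ∃ (_∈ cyc)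
  cycle-inhabited {cyc = []} (_ , _ , (_ , _ , () , _) , _)
  cycle-inhabited {cyc = h ∷ _} _ = h , here refl

module Condensation {n : ℕ} (D : Digraph n) (cyc : List (Fin n)) where

  _⟶_ : Rel (Fin n) 0ℓ
  _⟶_ = Arc' D cyc

  _⇝_ : Rel (Fin n) 0ℓ
  _⇝_ = Star _⟶_

  _≈_ : Rel (Fin n) 0ℓ
  x ≈ y = x ⇝ y × y ⇝ x

  ≈-refl : ∀ {x} → x ≈ x
  ≈-refl = ε , ε

  ≈-sym : ∀ {x y} → x ≈ y → y ≈ x
  ≈-sym (xy , yx) = yx , xy

  ≈-trans : ∀ {x y z} → x ≈ y → y ≈ z → x ≈ z
  ≈-trans (xy , yx) (yz , zy) = xy ◅◅ yz , zy ◅◅ yx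

  ≈-arc : ∀ {a b} → a ⟶ b → b ⇝ a → a ≈ b
  ≈-arc ab b⇝a = ab ◅ ε , b⇝a

  sameComp⇒≈ : ∀ {x y} → SameComp D cyc x y → x ≈ y
  sameComp⇒≈ (xy , yx) = reach⇒star xy , reach⇒star yx

  ≈⇒sameComp : ∀ {x y} → x ≈ y → SameComp D cyc x y
  ≈⇒sameComp (xy , yx) = star⇒reach xy , star⇒reach yx

  cycArc? : Decidable (CycArc cyc)
  cycArc? = consec? _≟_ (cyc ++ take 1 cyc)

  ⟶? : Decidable _⟶_
  ⟶? x y = (Digraph.adj D x y ≟ᵇ _) ×-dec ¬? (cycArc? x y)

  ≈? : Decidable _≈_
  ≈? x y = star? ⟶? x y ×-dec star? ⟶? y x

  harc : ∀ {x y a b} → x ≈ a → y ≈ b → a ⟶ b → ¬ a ≈ b → HArc D cyc x y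
  harc x≈a y≈b ab a≉b = _ , _ , ≈⇒sameComp x≈a , ≈⇒sameComp y≈b , ab , a≉b ∘ sameComp⇒≈

  minimal⇒closed : ∀ {u a b} → HMinimal D cyc u → a ⟶ b → b ≈ u → a ≈ u
  minimal⇒closed {a = a} {b} u-min ab b≈u with ≈? a b
  ... | yes a≈b = ≈-trans a≈b b≈u
  ... | no a≉b = ⊥-elim (u-min a (harc ≈-refl (≈-sym b≈u) ab a≉b))

  maximal⇒closed : ∀ {u a b} → HMaximal D cyc u → a ⟶ b → a ≈ u → b ≈ u
  maximal⇒closed {a = a} {b} u-max ab a≈u with ≈? a b
  ... | yes a≈b = ≈-trans (≈-sym a≈b) a≈u
  ... | no a≉b = ⊥-elim (u-max b (harc (≈-sym a≈u) ≈-refl ab a≉b))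

  _⟶_avoiding_⟶_ : Fin n → Fin n → Fin n → Fin n → Set
  x ⟶ y avoiding a ⟶ b = x ⟶ y × ¬ (x ≡ a × y ≡ b)

  WalkAvoiding : Fin n → Fin n → Rel (Fin n) 0ℓ
  WalkAvoiding a b = Star (λ x y → x ⟶ y avoiding a ⟶ b)

  walkAvoiding? : ∀ a b → Decidable (WalkAvoiding a b)
  walkAvoiding? a b = star? (λ x y → ⟶? x y ×-dec ¬? (x ≟ a ×-dec y ≟ b))

  walk-avoids-or-uses : ∀ {a b x y} → x ⇝ y → WalkAvoiding a b x y ⊎ (x ⇝ a × b ⇝ y)
  walk-avoids-or-uses {a} {b} w with walk-avoids-or-meets (λ u v → u ≟ a ×-dec v ≟ b) w
  ... | inj₁ w′ = inj₁ w′
  ... | inj₂ ((_ , _ , (refl , refl) , x⇝a) , (_ , _ , (refl , refl) , b⇝y)) =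
    inj₂ (Star.map proj₁ x⇝a , Star.map proj₁ b⇝y)

  CycleReachesOnlyVia : Fin n → Fin n → Set
  CycleReachesOnlyVia a b = ∀ {c} → c ∈ cyc → ¬ WalkAvoiding a b c b

  ReachesCycleOnlyVia : Fin n → Fin n → Set
  ReachesCycleOnlyVia a b = ∀ {c} → c ∈ cyc → ¬ WalkAvoiding a b a c

  record GuardedEntry (x : Fin n) : Set where
    constructor guardedEntry
    field
      src dst  : Fin n
      arc      : src ⟶ dst
      crossing : ¬ src ≈ dst
      enters   : dst ≈ x
      guarded  : CycleReachesOnlyVia src dst

  record GuardedExit (x : Fin n) : Set where
    constructor guardedExit
    field
      src dst  : Fin n
      arc      : src ⟶ dst
      crossing : ¬ src ≈ dst
      leaves   : src ≈ x
      guarded  : ReachesCycleOnlyVia src dst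

  module _ (isCycle : IsCycle D cyc) (minimal : MinimalStrong D) where

    private
      strong : ∀ x y → Star (Arc D) x y
      strong x y = reach⇒star (proj₁ minimal x y)

      cycle-vertex : Fin n
      cycle-vertex = proj₁ (cycle-inhabited {D = D} isCycle)

      cycle-vertex∈ : cycle-vertex ∈ cyc
      cycle-vertex∈ = proj₂ (cycle-inhabited {D = D} isCycle)

    reaches-cycle : ∀ x → ∃[ c ] (c ∈ cyc × x ⇝ c)
    reaches-cycle x with walk-avoids-or-meets cycArc? (strong x cycle-vertex)
    ... | inj₁ w = cycle-vertex , cycle-vertex∈ , w
    ... | inj₂ ((c , _ , cd , w) , _) = c , proj₁ (cycArc⇒∈ cd) , w

    reached-from-cycle : ∀ y → ∃[ c ] (c ∈ cyc × c ⇝ y)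
    reached-from-cycle y with walk-avoids-or-meets cycArc? (strong cycle-vertex y)
    ... | inj₁ w = cycle-vertex , cycle-vertex∈ , w
    ... | inj₂ (_ , (_ , d , cd , w)) = d , proj₂ (cycArc⇒∈ cd) , w

    no-cycle-bypass : ∀ {a b c} → a ⟶ b → c ∈ cyc → WalkAvoiding a b a c → CycleReachesOnlyVia a b
    no-cycle-bypass {a} {b} ab c∈ a⇝c c′∈ c′⇝b =
      proj₂ minimal a b (proj₁ ab , star⇒reach
        (Star.map forget a⇝c ◅◅ Star.map onCycle (cycArc* c∈ c′∈) ◅◅ Star.map forget c′⇝b))
      where
      forget : ∀ {x y} → x ⟶ y avoiding a ⟶ b → ArcWithout D a b x y
      forget ((xy , _) , ne) = xy , ne
      onCycle : ∀ {x y} → CycArc cyc x y → ArcWithout D a b x y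
      onCycle cxy = cycArc⇒arc {D = D} isCycle cxy , λ { (refl , refl) → proj₂ ab cxy }

    harc⇒guardedExit⊎guardedEntry : ∀ {x y} → HArc D cyc x y → GuardedExit x ⊎ GuardedEntry y
    harc⇒guardedExit⊎guardedEntry (a , b , x~a , y~b , ab , a≁b)
      with Any.any? (walkAvoiding? a b a) cyc
    ... | yes bypass = let _ , c∈ , a⇝c = find bypass in
      inj₂ (guardedEntry a b ab (a≁b ∘ ≈⇒sameComp) (≈-sym (sameComp⇒≈ y~b))
                         (no-cycle-bypass ab c∈ a⇝c))
    ... | no ¬bypass =
      inj₁ (guardedExit a b ab (a≁b ∘ ≈⇒sameComp) (≈-sym (sameComp⇒≈ x~a))
                        (λ c∈ a⇝c → ¬bypass (lose c∈ a⇝c)))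

    guardedEntry-after-minimal : ∀ {u₀ u₁} → HMinimal D cyc u₀ → HArc D cyc u₀ u₁ → GuardedEntry u₁
    guardedEntry-after-minimal {u₀} u₀-min (a , b , u₀~a , u₁~b , ab , a≁b) =
      guardedEntry a b ab a≉b (≈-sym (sameComp⇒≈ u₁~b)) guarded
      where
      a≉b : ¬ a ≈ b
      a≉b = a≁b ∘ ≈⇒sameComp
      a≈u₀ : a ≈ u₀
      a≈u₀ = ≈-sym (sameComp⇒≈ u₀~a)
      guarded : CycleReachesOnlyVia a b
      guarded c′∈ c′⇝b with reached-from-cycle a
      ... | c , c∈ , c⇝a
        with walk-avoids-or-uses {a} {b}
               (proj₁ a≈u₀ ◅◅ proj₂ (star-reflects (minimal⇒closed u₀-min) c⇝a a≈u₀))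
      ...   | inj₁ a⇝c = no-cycle-bypass ab c∈ a⇝c c′∈ c′⇝b
      ...   | inj₂ (_ , b⇝c) = a≉b (≈-arc ab (b⇝c ◅◅ c⇝a))

    no-guardedEntry-at-maximal : ∀ {x} → HMaximal D cyc x → ¬ GuardedEntry x
    no-guardedEntry-at-maximal x-max (guardedEntry a b ab a≉b b≈x guarded)
      with reaches-cycle b
    ... | c , c∈ , b⇝c
      with walk-avoids-or-uses {a} {b}
             (proj₁ (star-preserves (maximal⇒closed x-max) b⇝c b≈x) ◅◅ proj₂ b≈x)
    ...   | inj₁ c⇝b = guarded c∈ c⇝b
    ...   | inj₂ (c⇝a , _) = a≉b (≈-arc ab (b⇝c ◅◅ c⇝a))

    other-entries-internal : ∀ {x a′ b′} (e : GuardedEntry x) →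
      let open GuardedEntry e in a′ ⟶ b′ avoiding src ⟶ dst → b′ ≈ x → a′ ≈ b′
    other-entries-internal {a′ = a′} {b′} (guardedEntry a b ab a≉b b≈x guarded) a′b′ b′≈x =
      internal (≈-trans b′≈x (≈-sym b≈x))
      where
      internal : b′ ≈ b → a′ ≈ b′
      internal (b′⇝b , b⇝b′) with reached-from-cycle a′
      ... | c , c∈ , c⇝a′ with walk-avoids-or-uses {a} {b} c⇝a′
      ...   | inj₂ (_ , b⇝a′) = ≈-arc (proj₁ a′b′) (b′⇝b ◅◅ b⇝a′)
      ...   | inj₁ c⇝a′-avoiding with walk-avoids-or-uses {a} {b} b′⇝b
      ...     | inj₁ b′⇝b-avoiding = ⊥-elim (guarded c∈ (c⇝a′-avoiding ◅◅ a′b′ ◅ b′⇝b-avoiding))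
      ...     | inj₂ (b′⇝a , _) = ⊥-elim (a≉b (≈-arc ab (b⇝b′ ◅◅ b′⇝a)))

    other-exits-internal : ∀ {x a′ b′} (e : GuardedExit x) →
      let open GuardedExit e in a′ ⟶ b′ avoiding src ⟶ dst → a′ ≈ x → a′ ≈ b′
    other-exits-internal {a′ = a′} {b′} (guardedExit a b ab a≉b a≈x guarded) a′b′ a′≈x =
      internal (≈-trans a≈x (≈-sym a′≈x))
      where
      internal : a ≈ a′ → a′ ≈ b′
      internal (a⇝a′ , a′⇝a) with reaches-cycle b′
      ... | c , c∈ , b′⇝c with walk-avoids-or-uses {a} {b} b′⇝c
      ...   | inj₂ (b′⇝a , _) = ≈-arc (proj₁ a′b′) (b′⇝a ◅◅ a⇝a′)
      ...   | inj₁ b′⇝c-avoiding with walk-avoids-or-uses {a} {b} a⇝a′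
      ...     | inj₁ a⇝a′-avoiding = ⊥-elim (guarded c∈ (a⇝a′-avoiding ◅◅ a′b′ ◅ b′⇝c-avoiding))
      ...     | inj₂ (_ , b⇝a′) = ⊥-elim (a≉b (≈-arc ab (b⇝a′ ◅◅ a′⇝a)))

    guarded⇒linear : ∀ {x} → GuardedEntry x → GuardedExit x → HLinear D cyc x
    guarded⇒linear {x} entry@(guardedEntry a b ab a≉b b≈x _) exit@(guardedExit a₂ b₂ a₂b₂ a₂≉b₂ a₂≈x _) =
      (a , harc ≈-refl (≈-sym b≈x) ab a≉b , in-neighbour-unique) ,
      (b₂ , harc (≈-sym a₂≈x) ≈-refl a₂b₂ a₂≉b₂ , out-neighbour-unique)
      where
      in-neighbour-unique : ∀ z → HArc D cyc z x → SameComp D cyc z a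
      in-neighbour-unique z (a′ , b′ , z~a′ , x~b′ , a′b′ , a′≁b′) with a′ ≟ a ×-dec b′ ≟ b
      ... | yes (refl , refl) = z~a′
      ... | no ne = ⊥-elim (a′≁b′ (≈⇒sameComp
                      (other-entries-internal entry (a′b′ , ne) (≈-sym (sameComp⇒≈ x~b′)))))
      out-neighbour-unique : ∀ z → HArc D cyc x z → SameComp D cyc z b₂
      out-neighbour-unique z (a′ , b′ , x~a′ , z~b′ , a′b′ , a′≁b′) with a′ ≟ a₂ ×-dec b′ ≟ b₂
      ... | yes (refl , refl) = z~b′
      ... | no ne = ⊥-elim (a′≁b′ (≈⇒sameComp
                      (other-exits-internal exit (a′b′ , ne) (≈-sym (sameComp⇒≈ x~a′)))))

    linear-on-path : ∀ {x uⱼ} xs → GuardedEntry x → Linked (HArc D cyc) (x ∷ xs) →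
                     last (x ∷ xs) ≡ just uⱼ → HMaximal D cyc uⱼ → Any (HLinear D cyc) (x ∷ xs)
    linear-on-path [] entry _ refl uⱼ-max = ⊥-elim (no-guardedEntry-at-maximal uⱼ-max entry)
    linear-on-path (y ∷ xs) entry (xy ∷ linked) last≡ uⱼ-max
      with harc⇒guardedExit⊎guardedEntry xy
    ... | inj₁ exit = here (guarded⇒linear entry exit)
    ... | inj₂ entry′ = there (linear-on-path xs entry′ linked last≡ uⱼ-max)

lemma5 : {n : ℕ} (D : Digraph n) → MinimalStrong D
       → (cyc : List (Fin n)) → length cyc ≥ 2 → IsCycle D cyc
       → (u₀ uⱼ : Fin n) (us : List (Fin n)) → HPath D cyc u₀ uⱼ us
       → HMinimal D cyc u₀ → HMaximal D cyc uⱼ → ¬ SameComp D cyc u₀ uⱼ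
       → Any (HLinear D cyc) us
lemma5 D minimal cyc _ isCycle u₀ uⱼ [] (_ , _ , () , _) _ _ _
lemma5 D minimal cyc _ isCycle u₀ uⱼ (_ ∷ []) (_ , _ , refl , refl) _ _ u₀≁uⱼ =
  ⊥-elim (u₀≁uⱼ (≈⇒sameComp ≈-refl))
  where open Condensation D cyc
lemma5 D minimal cyc _ isCycle u₀ uⱼ (_ ∷ u₁ ∷ us) (u₀u₁ ∷ linked , _ , refl , last≡) u₀-min uⱼ-max _ =
  there (linear-on-path isCycle minimal us
           (guardedEntry-after-minimal isCycle minimal u₀-min u₀u₁) linked last≡ uⱼ-max)
  where open Condensation D cyc
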